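{- Let $A$ be a finite nonempty set in an arbitrary commutative group, write $|A|=n$, and assume that $\min(|A+A|,|A-A|)\leq Kn$ for some real $K$. Then there is a set $T\subseteq A+A$ with $|T|\leq 2K^2-1$ such that for every positive integer $m$, \[ (m+1)(A-A)\subseteq (A-A)+m(T-T). \]
   Context: For sets $X,Y$, $X+Y=\{x+y\}$, $X-Y=\{x-y\}$, and for a positive integer $m$, $mX=X+\dots+X$ ($m$ summands) denotes the $m$-fold iterated sumset (not a dilate).
   Formalization: The constant K ranges over the rationals rather than the reals. -}

module Defs where

open import Level using (Level; _⊔_)
open import Data.Nat using (ℕ; zero; suc)
open import Data.Integer using (+_)
open import Data.Rational using (ℚ; _/_)
open import Relation.Binary.PropositionalEquality using (_≡_)
open import Data.Product using (Σ; ∃; _×_; _,_)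
open import Data.List using (List; length)
open import Algebra.Bundles using (AbelianGroup)
import Data.List.Membership.Setoid as MemS
import Data.List.Relation.Unary.Unique.Setoid as UniqS

ℕ→ℚ : ℕ → ℚ
ℕ→ℚ n = (+ n) / 1

module Sumsets {c ℓ : Level} (G : AbelianGroup c ℓ) where
  open AbelianGroup G

  SubsetG : Set (Level.suc (c ⊔ ℓ))
  SubsetG = Carrier → Set (c ⊔ ℓ)

  ⟦_⟧ : List Carrier → SubsetG
  ⟦ L ⟧ x = MemS._∈_ setoid x L

  _⊆_ : SubsetG → SubsetG → Set (c ⊔ ℓ)
  X ⊆ Y = ∀ x → X x → Y x

  _⊕_ : SubsetG → SubsetG → SubsetG
  (X ⊕ Y) z = Σ Carrier λ x → Σ Carrier λ y → X x × Y y × (z ≈ x ∙ y)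

  _⊖_ : SubsetG → SubsetG → SubsetG
  (X ⊖ Y) z = Σ Carrier λ x → Σ Carrier λ y → X x × Y y × (z ≈ x ∙ (y ⁻¹))

  _·_ : ℕ → SubsetG → SubsetG
  (zero · X) z = Lift (c ⊔ ℓ) (z ≈ ε)
    where open Level using (Lift)
  (suc m · X) = X ⊕ (m · X)

  HasCard : SubsetG → ℕ → Set (c ⊔ ℓ)
  HasCard X k = Σ (List Carrier) λ L →
    UniqS.Unique setoid L × (length L ≡ k) × (∀ x → X x → ⟦ L ⟧ x) × (∀ x → ⟦ L ⟧ x → X x)

{-# OPTIONS --safe #-}
module Submission where

-- Let ± be + or −, whichever makes |A ± A| ≤ K·|A|. By Petridis' argument, a nonempty W ⊆ A minimising
-- |W ± A| / |W| satisfies |W ± A ± C| · |W| ≤ |W ± A| · |W ± C| for all C ⊆ A; with C = A and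
-- |W ± A| ≤ K·|W| this gives |W ± A ± A| ≤ K²·|W|. Start T with one element of A + A and scan A + A,
-- adding t to T whenever at most half of W ± t is covered by W ± T: the translates W ± t then cover at
-- least (|T| + 1)·|W| / 2 elements of W ± A ± A, so |T| + 1 ≤ 2K². Afterwards more than half of every
-- W ± p (p ∈ A + A) is covered, so for p, p′ ∈ A + A some w ∈ W has w ± p = w₁ ± t and w ± p′ = w₂ ± t′
-- with t, t′ ∈ T, i.e. p − p′ ∈ (A − A) + (T − T). As (A − A) + (A − A) = (A + A) − (A + A), this is
-- 2(A − A) ⊆ (A − A) + (T − T), and induction on m gives the rest.

open import Defs
open import Level using (Level)
open import Data.Nat using (ℕ; suc; _≥_)
open import Data.Product using (Σ; _×_; _,_)
open import Data.Sum using (_⊎_; [_,_]′)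
open import Data.List using (List; length)
open import Algebra.Bundles using (AbelianGroup)
open import Relation.Binary.Bundles using (Setoid; DecSetoid)
open import Relation.Binary.Definitions using (DecidableEquality)
open import Relation.Nullary using (Dec)
import Data.List.Relation.Unary.Unique.Setoid as UniqS

module ListProperties where
  open import Data.Nat using (_+_; _≤_; _<_; z≤n; s≤s)
  open import Data.Nat.Properties using (m≤n⇒m≤1+n; ≤-pred; +-suc; <-trans; n<1+n)
  open import Data.Fin using (zero; suc)
  open import Data.List using ([]; _∷_; filter; map; lookup)
  open import Data.List.Relation.Unary.Any using (here; there)
  open import Data.List.Relation.Unary.All as All using ()
  open import Data.List.Relation.Unary.AllPairs using (AllPairs; []; _∷_)
  open import Data.List.Membership.Propositional using (_∈_)
  open import Data.List.Membership.Propositional.Properties using (∈-lookup)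
  open import Data.List.Relation.Binary.Subset.Propositional using (_⊆_)
  open import Data.List.Relation.Binary.Sublist.Propositional using (_∷ʳ_; _∷_) renaming (_⊆_ to _⊑_; [] to []ˢ)
  open import Data.List.Relation.Binary.Sublist.Propositional.Properties using (All-resp-⊆)
  open import Data.List.Relation.Unary.Unique.Setoid using (Unique)
  open import Data.Product using (∃; map₁; map₂)
  open import Data.Empty using (⊥-elim)
  open import Function using (_∘_)
  open import Relation.Nullary using (¬_; yes; no)
  open import Relation.Unary using (Pred; Decidable)
  open import Relation.Unary.Properties using (∁?)
  open import Relation.Binary.PropositionalEquality as ≡ using (_≡_)

  module _ {a p : Level} {A : Set a} {P : Pred A p} (P? : Decidable P) where

    length-filter-∁ : ∀ xs → length (filter P? xs) + length (filter (∁? P?) xs) ≡ length xs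
    length-filter-∁ [] = ≡.refl
    length-filter-∁ (x ∷ xs) with P? x
    ... | yes _ = ≡.cong suc (length-filter-∁ xs)
    ... | no _ = ≡.trans (+-suc _ _) (≡.cong suc (length-filter-∁ xs))

  module _ {a p q : Level} {A : Set a} {P : Pred A p} {Q : Pred A q}
           (P? : Decidable P) (Q? : Decidable Q) (P⇒Q : ∀ {x} → P x → Q x) where

    length-filter-mono : ∀ xs → length (filter P? xs) ≤ length (filter Q? xs)
    length-filter-mono [] = z≤n
    length-filter-mono (x ∷ xs) with P? x | Q? x
    ... | yes _  | yes _  = s≤s (length-filter-mono xs)
    ... | yes px | no ¬qx = ⊥-elim (¬qx (P⇒Q px))
    ... | no _   | yes _  = m≤n⇒m≤1+n (length-filter-mono xs)
    ... | no _   | no _   = length-filter-mono xs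

    length-filter-< : ∀ {xs y} → y ∈ xs → ¬ P y → Q y → length (filter P? xs) < length (filter Q? xs)
    length-filter-< {x ∷ xs} (here ≡.refl) ¬py qy with P? x | Q? x
    ... | yes py | _      = ⊥-elim (¬py py)
    ... | no _   | no ¬qy = ⊥-elim (¬qy qy)
    ... | no _   | yes _  = s≤s (length-filter-mono xs)
    length-filter-< {x ∷ xs} (there y∈xs) ¬py qy with P? x | Q? x
    ... | yes _  | yes _  = s≤s (length-filter-< y∈xs ¬py qy)
    ... | yes px | no ¬qx = ⊥-elim (¬qx (P⇒Q px))
    ... | no _   | yes _  = m≤n⇒m≤1+n (length-filter-< y∈xs ¬py qy)
    ... | no _   | no _   = length-filter-< y∈xs ¬py qy

  module _ {a b p : Level} {A : Set a} {B : Set b} {P : Pred B p} (P? : Decidable P) (f : A → B) where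

    length-filter-map : ∀ xs → length (filter P? (map f xs)) ≡ length (filter (P? ∘ f) xs)
    length-filter-map [] = ≡.refl
    length-filter-map (x ∷ xs) with P? (f x)
    ... | yes _ = ≡.cong suc (length-filter-map xs)
    ... | no _ = length-filter-map xs

    filter-map-⊆ : ∀ {q} {Q : Pred A q} (Q? : Decidable Q) → (∀ {x} → P (f x) → Q x) →
      ∀ xs → filter P? (map f xs) ⊆ map f (filter Q? xs)
    filter-map-⊆ Q? P⇒Q [] ()
    filter-map-⊆ Q? P⇒Q (x ∷ xs) with P? (f x) | Q? x
    ... | yes _   | yes _  = λ { (here eq) → here eq ; (there y∈) → there (filter-map-⊆ Q? P⇒Q xs y∈) }
    ... | yes pfx | no ¬qx = ⊥-elim (¬qx (P⇒Q pfx))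
    ... | no _    | yes _  = there ∘ filter-map-⊆ Q? P⇒Q xs
    ... | no _    | no _   = filter-map-⊆ Q? P⇒Q xs

  filter-pigeonhole : ∀ {a p q} {A : Set a} {P : Pred A p} {Q : Pred A q} (P? : Decidable P) (Q? : Decidable Q) xs →
    length xs < length (filter P? xs) + length (filter Q? xs) → ∃ λ x → x ∈ xs × P x × Q x
  filter-pigeonhole P? Q? (x ∷ xs) size with P? x | Q? x
  ... | yes px | yes qx = x , here ≡.refl , px , qx
  ... | yes _  | no _   = map₂ (map₁ there) (filter-pigeonhole P? Q? xs (≤-pred size))
  ... | no _   | yes _  = map₂ (map₁ there)
    (filter-pigeonhole P? Q? xs (≤-pred (≡.subst (suc (length xs) <_) (+-suc _ _) size)))
  ... | no _   | no _   = map₂ (map₁ there) (filter-pigeonhole P? Q? xs (<-trans (n<1+n _) size))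

  lookup-injective : ∀ {c ℓ} (S : Setoid c ℓ) → let open Setoid S in
    ∀ {xs} → Unique S xs → ∀ i j → lookup xs i ≈ lookup xs j → i ≡ j
  lookup-injective S (_ ∷ _) zero zero _ = ≡.refl
  lookup-injective S (x≉ ∷ _) zero (suc j) eq = ⊥-elim (All.lookup x≉ (∈-lookup j) eq)
  lookup-injective S (x≉ ∷ _) (suc i) zero eq = ⊥-elim (All.lookup x≉ (∈-lookup i) (Setoid.sym S eq))
  lookup-injective S (_ ∷ xs!) (suc i) (suc j) eq = ≡.cong suc (lookup-injective S xs! i j eq)

  AllPairs-resp-⊑ : ∀ {a r} {A : Set a} {R : A → A → Set r} {xs ys : List A} → xs ⊑ ys → AllPairs R ys → AllPairs R xs
  AllPairs-resp-⊑ []ˢ [] = []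
  AllPairs-resp-⊑ (y ∷ʳ xs⊑ys) (_ ∷ rys) = AllPairs-resp-⊑ xs⊑ys rys
  AllPairs-resp-⊑ (≡.refl ∷ xs⊑ys) (rx ∷ rys) = All-resp-⊆ xs⊑ys rx ∷ AllPairs-resp-⊑ xs⊑ys rys

module Counting {c ℓ : Level} (S : DecSetoid c ℓ) where
  open import Data.Nat using (_+_; _≤_; z≤n; s≤s)
  open import Data.Nat.Properties using (≤-antisym; module ≤-Reasoning)
  open import Data.List using ([]; _∷_; _++_; filter; deduplicate)
  open import Data.List.Properties using (length-removeAt′; length-deduplicate)
  open import Data.List.Relation.Unary.Any using (here; there; _─_; index)
  open import Data.List.Relation.Unary.All using (lookupWith)
  open import Data.List.Relation.Unary.AllPairs using (_∷_)
  open import Data.Product using (proj₂)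
  open import Data.Sum using (inj₁; inj₂) renaming (map₂ to ⊎-map₂)
  open import Data.Empty using (⊥-elim)
  open import Function using (_∘_; id)
  open import Relation.Nullary using (¬_)
  open import Relation.Unary using (Pred; ∁; Decidable)
  open import Relation.Unary.Properties using (∁?)
  open import Relation.Binary using (_Respects_)
  open import Relation.Binary.PropositionalEquality as ≡ using (_≡_)
  open import Data.List.Membership.Setoid.Properties as Membershipₚ using ()
  open import Data.List.Relation.Binary.Subset.Setoid.Properties as Subsetₚ using ()
  open import Data.List.Relation.Unary.Unique.Setoid.Properties as Uniqueₚ using ()
  open import Data.List.Relation.Unary.Unique.DecSetoid.Properties as DecUniqueₚ using ()
  open ListProperties using (length-filter-∁)

  open DecSetoid S renaming (Carrier to A)
  open import Data.List.Membership.Setoid setoid using (_∈_; _∉_)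
  open import Data.List.Membership.DecSetoid S using (_∈?_)
  open import Data.List.Relation.Binary.Subset.Setoid setoid using (_⊆_)
  open import Data.List.Relation.Unary.Unique.Setoid setoid using (Unique)

  count : List A → ℕ
  count xs = length (deduplicate _≟_ xs)

  private
    ⊆-refl : ∀ {xs} → xs ⊆ xs
    ⊆-refl = Subsetₚ.⊆-refl setoid

    ⊆-trans : ∀ {xs ys zs} → xs ⊆ ys → ys ⊆ zs → xs ⊆ zs
    ⊆-trans = Subsetₚ.⊆-trans setoid

    ∈-─ : ∀ {x y ys} (x∈ys : x ∈ ys) → y ∈ ys → y ≈ x ⊎ y ∈ (ys ─ x∈ys)
    ∈-─ (here x≈z) (here y≈z) = inj₁ (trans y≈z (sym x≈z))
    ∈-─ (here _) (there y∈ys) = inj₂ y∈ys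
    ∈-─ (there _) (here y≈z) = inj₂ (here y≈z)
    ∈-─ (there x∈ys) (there y∈ys) = ⊎-map₂ there (∈-─ x∈ys y∈ys)

  unique-⊆⇒length≤ : ∀ {xs ys} → Unique xs → xs ⊆ ys → length xs ≤ length ys
  unique-⊆⇒length≤ {[]} _ _ = z≤n
  unique-⊆⇒length≤ {x ∷ xs} {ys} (x≉xs ∷ xs!) x∷xs⊆ys = begin
    suc (length xs)          ≤⟨ s≤s (unique-⊆⇒length≤ xs! xs⊆ys─x) ⟩
    suc (length (ys ─ x∈ys)) ≡⟨ ≡.sym (length-removeAt′ ys (index x∈ys)) ⟩
    length ys                ∎
    where
    open ≤-Reasoning
    x∈ys : x ∈ ys
    x∈ys = x∷xs⊆ys (here refl)
    x≉ : ∀ {y} → y ∈ xs → ¬ y ≈ x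
    x≉ y∈xs y≈x = lookupWith (λ x≉z y≈z → x≉z (trans (sym y≈x) y≈z)) x≉xs y∈xs
    xs⊆ys─x : xs ⊆ (ys ─ x∈ys)
    xs⊆ys─x y∈xs = [ ⊥-elim ∘ x≉ y∈xs , id ]′ (∈-─ x∈ys (x∷xs⊆ys (there y∈xs)))

  deduplicate-⊆ : ∀ xs → deduplicate _≟_ xs ⊆ xs
  deduplicate-⊆ xs = Membershipₚ.∈-deduplicate⁻ setoid _≟_ xs

  ⊆-deduplicate : ∀ xs → xs ⊆ deduplicate _≟_ xs
  ⊆-deduplicate xs = Membershipₚ.∈-deduplicate⁺ setoid _≟_ (λ z≈y x≈y → trans x≈y (sym z≈y))

  deduplicate-unique : ∀ xs → Unique (deduplicate _≟_ xs)
  deduplicate-unique = DecUniqueₚ.deduplicate-! S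

  count≤length : ∀ xs → count xs ≤ length xs
  count≤length = length-deduplicate _≟_

  count-unique : ∀ {xs ys} → Unique xs → xs ⊆ ys → ys ⊆ xs → count ys ≡ length xs
  count-unique {xs} {ys} xs! xs⊆ys ys⊆xs = ≤-antisym
    (unique-⊆⇒length≤ (deduplicate-unique ys) (⊆-trans (deduplicate-⊆ ys) ys⊆xs))
    (unique-⊆⇒length≤ xs! (⊆-trans xs⊆ys (⊆-deduplicate ys)))

  count-of-unique : ∀ {xs} → Unique xs → count xs ≡ length xs
  count-of-unique xs! = count-unique xs! ⊆-refl ⊆-refl

  count-mono : ∀ {xs ys} → xs ⊆ ys → count xs ≤ count ys
  count-mono {xs} {ys} xs⊆ys = unique-⊆⇒length≤ (deduplicate-unique xs)
    (⊆-trans (deduplicate-⊆ xs) (⊆-trans xs⊆ys (⊆-deduplicate ys)))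

  count-cong : ∀ {xs ys} → xs ⊆ ys → ys ⊆ xs → count xs ≡ count ys
  count-cong xs⊆ys ys⊆xs = ≤-antisym (count-mono xs⊆ys) (count-mono ys⊆xs)

  private
    count-filter : ∀ {q} {Q : Pred A q} (Q? : Decidable Q) → Q Respects _≈_ → ∀ xs →
      count (filter Q? xs) ≡ length (filter Q? (deduplicate _≟_ xs))
    count-filter Q? Q-resp xs = count-unique (Uniqueₚ.filter⁺ setoid Q? (deduplicate-unique xs))
      (Subsetₚ.filter⁺′ setoid Q? Q-resp Q? Q-resp id (deduplicate-⊆ xs))
      (Subsetₚ.filter⁺′ setoid Q? Q-resp Q? Q-resp id (⊆-deduplicate xs))

  count-partition : ∀ {p} {P : Pred A p} (P? : Decidable P) → P Respects _≈_ →
    ∀ xs → count xs ≡ count (filter P? xs) + count (filter (∁? P?) xs)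
  count-partition {P = P} P? P-resp xs = ≡.sym (≡.trans
    (≡.cong₂ _+_ (count-filter P? P-resp xs) (count-filter (∁? P?) ∁-resp xs))
    (length-filter-∁ P? (deduplicate _≟_ xs)))
    where
    ∁-resp : ∁ P Respects _≈_
    ∁-resp x≈y ¬Px Py = ¬Px (P-resp (sym x≈y) Py)

  count-++ : ∀ xs ys → count (xs ++ ys) ≡ count xs + count (filter (∁? (_∈? xs)) ys)
  count-++ xs ys = ≡.trans (count-partition (_∈? xs) ∈-resp (xs ++ ys))
    (≡.cong₂ _+_ (count-cong old⊆xs xs⊆old) (count-cong new⊆ new⊇))
    where
    ∈-resp : (_∈ xs) Respects _≈_
    ∈-resp = Membershipₚ.∈-resp-≈ setoid
    ∉-resp : (_∉ xs) Respects _≈_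
    ∉-resp = Membershipₚ.∉-resp-≈ setoid
    old⊆xs : filter (_∈? xs) (xs ++ ys) ⊆ xs
    old⊆xs v∈ = proj₂ (Membershipₚ.∈-filter⁻ setoid (_∈? xs) ∈-resp {xs = xs ++ ys} v∈)
    xs⊆old : xs ⊆ filter (_∈? xs) (xs ++ ys)
    xs⊆old v∈ = Membershipₚ.∈-filter⁺ setoid (_∈? xs) ∈-resp (Membershipₚ.∈-++⁺ˡ setoid v∈) v∈
    new⊆ : filter (∁? (_∈? xs)) (xs ++ ys) ⊆ filter (∁? (_∈? xs)) ys
    new⊆ v∈ with Membershipₚ.∈-filter⁻ setoid (∁? (_∈? xs)) ∉-resp {xs = xs ++ ys} v∈
    ... | v∈xs++ys , v∉xs = Membershipₚ.∈-filter⁺ setoid (∁? (_∈? xs)) ∉-resp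
      ([ ⊥-elim ∘ v∉xs , id ]′ (Membershipₚ.∈-++⁻ setoid xs v∈xs++ys)) v∉xs
    new⊇ : filter (∁? (_∈? xs)) ys ⊆ filter (∁? (_∈? xs)) (xs ++ ys)
    new⊇ = Subsetₚ.filter⁺′ setoid (∁? (_∈? xs)) ∉-resp (∁? (_∈? xs)) ∉-resp id (Subsetₚ.xs⊆ys++xs setoid ys xs)

module CountingMaps where
  open import Data.Nat using (_≤_)
  open import Data.Nat.Properties using (module ≤-Reasoning)
  open import Data.Fin using (Fin)
  open import Data.Fin.Properties using (≡-decSetoid)
  open import Data.List using (map; deduplicate; allFin)
  open import Data.List.Properties using (length-map; length-tabulate)
  open import Data.List.Membership.Propositional.Properties using (∈-allFin)
  open import Function using (id)
  open import Relation.Binary using (_Preserves_⟶_)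
  open import Relation.Binary.PropositionalEquality as ≡ using (_≡_)
  open import Data.List.Relation.Binary.Subset.Setoid.Properties as Subsetₚ using ()
  open import Data.List.Relation.Unary.Unique.Setoid.Properties as Uniqueₚ using ()

  module _ {c₁ ℓ₁ c₂ ℓ₂ : Level} (S : DecSetoid c₁ ℓ₁) (T : DecSetoid c₂ ℓ₂) where
    private
      module S = DecSetoid S
      module T = DecSetoid T
      module CS = Counting S
      module CT = Counting T

    count-map : ∀ {f : S.Carrier → T.Carrier} → f Preserves S._≈_ ⟶ T._≈_ →
      (∀ {x y} → f x T.≈ f y → x S.≈ y) → ∀ xs → CT.count (map f xs) ≡ CS.count xs
    count-map {f} f-pres f-inj xs = ≡.trans
      (CT.count-unique (Uniqueₚ.map⁺ S.setoid T.setoid f-inj (CS.deduplicate-unique xs))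
        (Subsetₚ.map⁺ S.setoid T.setoid f-pres (CS.deduplicate-⊆ xs))
        (Subsetₚ.map⁺ S.setoid T.setoid f-pres (CS.⊆-deduplicate xs)))
      (length-map f (deduplicate S._≟_ xs))

  module _ {c ℓ : Level} (S : DecSetoid c ℓ) where
    open DecSetoid S renaming (Carrier to A)
    open Counting S

    count≤ : ∀ {m} (f : A → Fin m) → (∀ {x y} → f x ≡ f y → x ≈ y) → ∀ xs → count xs ≤ m
    count≤ {m} f f-inj xs = begin
      count xs                            ≡⟨ ≡.sym (length-map f (deduplicate _≟_ xs)) ⟩
      length (map f (deduplicate _≟_ xs)) ≤⟨ Counting.unique-⊆⇒length≤ (≡-decSetoid m)
                                               (Uniqueₚ.map⁺ setoid (≡.setoid (Fin m)) f-inj (deduplicate-unique xs))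
                                               (λ _ → ∈-allFin _) ⟩
      length (allFin m)                   ≡⟨ length-tabulate id ⟩
      m                                   ∎
      where open ≤-Reasoning

open import Data.List.Membership.Propositional using (_∈_)

module Reachability {a : Level} {S : Set a} (_≟_ : DecidableEquality S)
                    (elems : List S) (elems-complete : ∀ s → s ∈ elems) where
  open import Level using (_⊔_)
  open import Data.Nat using (zero; _+_; _≤_; s≤s)
  open import Data.Nat.Properties using (<-≤-trans; <⇒≱; +-comm)
  open import Data.List using (filter)
  open import Data.List.Properties using (length-filter; filter-some)
  open import Data.List.Relation.Unary.Any as Any using (Any; any?)
  open import Data.List.Membership.Propositional using (find)
  open import Data.Product using (∃)
  open import Data.Sum using (inj₁; inj₂)
  open import Data.Empty using (⊥-elim)
  open import Relation.Nullary using (yes; no; ¬?)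
  open import Relation.Nullary.Decidable using (_×-dec_; _⊎-dec_; map′)
  open import Relation.Binary using (Rel; Decidable)
  open import Relation.Binary.PropositionalEquality as ≡ using (_≡_)
  open import Relation.Binary.Construct.Closure.ReflexiveTransitive using (Star; ε; _◅_)
  open import Relation.Binary.Construct.Closure.Symmetric using (SymClosure; fwd; bwd)
  open import Relation.Binary.Construct.Closure.Equivalence using (EqClosure)
  open ListProperties using (length-filter-<)

  module _ {ℓ : Level} {R : Rel S ℓ} (R? : Decidable R) where

    -- t can be reached from s in at most k + 1 steps
    Within : ℕ → S → S → Set (a ⊔ ℓ)
    Within zero s t = s ≡ t ⊎ R s t
    Within (suc k) s t = Within k s t ⊎ Any (λ u → R s u × Within k u t) elems

    within? : ∀ k → Decidable (Within k)
    within? zero s t = (s ≟ t) ⊎-dec R? s t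
    within? (suc k) s t = within? k s t ⊎-dec any? (λ u → R? s u ×-dec within? k u t) elems

    within⇒star : ∀ k {s t} → Within k s t → Star R s t
    within⇒star zero (inj₁ ≡.refl) = ε
    within⇒star zero (inj₂ r) = r ◅ ε
    within⇒star (suc k) (inj₁ w) = within⇒star k w
    within⇒star (suc k) (inj₂ any) = let _ , _ , r , w = find any in r ◅ within⇒star k w

    within-step : ∀ k {s u t} → R s u → Within k u t → Within (suc k) s t
    within-step k {u = u} r w = inj₂ (Any.map (λ { ≡.refl → r , w }) (elems-complete u))

    within-mono : ∀ j {k s t} → Within k s t → Within (j + k) s t
    within-mono zero w = w
    within-mono (suc j) w = inj₁ (within-mono j w)

    star⇒within : ∀ {s t} → Star R s t → ∃ λ k → Within k s t
    star⇒within ε = 0 , inj₁ ≡.refl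
    star⇒within (r ◅ path) = let k , w = star⇒within path in suc k , within-step k r w

    Stable : ℕ → S → Set (a ⊔ ℓ)
    Stable k t = ∀ s → Within (suc k) s t → Within k s t

    stable-suc : ∀ {k t} → Stable k t → Stable (suc k) t
    stable-suc stable s (inj₁ w) = w
    stable-suc {k} stable s (inj₂ any) = let u , _ , r , w = find any in within-step k r (stable u w)

    stable-+ : ∀ j {k t} → Stable k t → Stable (j + k) t
    stable-+ zero stable = stable
    stable-+ (suc j) stable = stable-suc (stable-+ j stable)

    stable-collapse : ∀ j {k s t} → Stable k t → Within (j + k) s t → Within k s t
    stable-collapse zero stable w = w
    stable-collapse (suc j) {s = s} stable w = stable-collapse j stable (stable-+ j stable s w)

    reached : ℕ → S → ℕ
    reached k t = length (filter (λ s → within? k s t) elems)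

    stable-or-growing : ∀ k t → Stable k t ⊎ suc k ≤ reached k t
    stable-or-growing zero t =
      inj₂ (filter-some (λ s → within? 0 s t) (Any.map (λ { ≡.refl → inj₁ ≡.refl }) (elems-complete t)))
    stable-or-growing (suc k) t with stable-or-growing k t
    ... | inj₁ stable = inj₁ (stable-suc stable)
    ... | inj₂ growing with any? (λ s → within? (suc k) s t ×-dec ¬? (within? k s t)) elems
    ... | yes new = let s , s∈ , w , ¬w = find new in
      inj₂ (<-≤-trans (s≤s growing) (length-filter-< (λ s → within? k s t) (λ s → within? (suc k) s t) inj₁ s∈ ¬w w))
    ... | no ¬new = inj₁ (stable-suc stable)
      where
      stable : Stable k t
      stable s w with within? k s t
      ... | yes w′ = w′
      ... | no ¬w = ⊥-elim (¬new (Any.map (λ { ≡.refl → w , ¬w }) (elems-complete s)))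

    -- Each unstable step reaches a new vertex, and there are only length elems of them.
    stable-at-size : ∀ t → Stable (length elems) t
    stable-at-size t with stable-or-growing (length elems) t
    ... | inj₁ stable = stable
    ... | inj₂ growing = ⊥-elim (<⇒≱ growing (length-filter _ elems))

    star? : Decidable (Star R)
    star? s t = map′ (within⇒star N) star⇒within-N (within? N s t)
      where
      N = length elems
      star⇒within-N : Star R s t → Within N s t
      star⇒within-N path = let k , w = star⇒within path in
        stable-collapse k (stable-at-size t) (≡.subst (λ m → Within m s t) (+-comm N k) (within-mono N w))

  eqClosure? : ∀ {ℓ} {R : Rel S ℓ} → Decidable R → Decidable (EqClosure R)
  eqClosure? {R = R} R? = star? symClosure?
    where
    symClosure? : Decidable (SymClosure R)
    symClosure? s t = map′ [ fwd , bwd ]′ (λ { (fwd r) → inj₁ r ; (bwd r) → inj₂ r }) (R? s t ⊎-dec R? t s)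

module Greedy {a p : Level} {A : Set a} (Good : List A → A → Set p) (good? : ∀ T x → Dec (Good T x)) where
  open import Data.List.Relation.Binary.Subset.Propositional using (_⊆_)
  open import Data.List using ([]; _∷_)
  open import Data.List.Relation.Unary.Any using (here; there)
  open import Function using (_∘_; id)
  open import Relation.Nullary using (¬_; yes; no)
  open import Relation.Binary.PropositionalEquality as ≡ using (_≡_)

  greedy : List A → List A → List A
  greedy T [] = T
  greedy T (x ∷ xs) with good? T x
  ... | yes _ = greedy T xs
  ... | no _ = greedy (x ∷ T) xs

  greedy-⊇ : ∀ T xs → T ⊆ greedy T xs
  greedy-⊇ T [] = id
  greedy-⊇ T (x ∷ xs) with good? T x
  ... | yes _ = greedy-⊇ T xs
  ... | no _ = greedy-⊇ (x ∷ T) xs ∘ there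

  greedy-invariant : ∀ {i} (Inv : List A → Set i) → (∀ T x → ¬ Good T x → Inv T → Inv (x ∷ T)) →
    ∀ T xs → Inv T → Inv (greedy T xs)
  greedy-invariant Inv step T [] inv = inv
  greedy-invariant Inv step T (x ∷ xs) inv with good? T x
  ... | yes _ = greedy-invariant Inv step T xs inv
  ... | no bad = greedy-invariant Inv step (x ∷ T) xs (step T x bad inv)

  greedy-good : (∀ {T T′ x} → T ⊆ T′ → Good T x → Good T′ x) → (∀ T x → Good (x ∷ T) x) →
    ∀ T xs {x} → x ∈ xs → Good (greedy T xs) x
  greedy-good mono added T (x ∷ xs) (here ≡.refl) with good? T x
  ... | yes good = mono (greedy-⊇ T xs) good
  ... | no _ = mono (greedy-⊇ (x ∷ T) xs) (added T x)
  greedy-good mono added T (x ∷ xs) (there x∈) with good? T x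
  ... | yes _ = greedy-good mono added T xs x∈
  ... | no _ = greedy-good mono added (x ∷ T) xs x∈

module MinimalRatio {a : Level} {A : Set a} where
  open import Data.Nat using (pred; _*_; _≤_; _<_; z≤n; s≤s; _<?_)
  open import Data.Nat.Properties using (*-zeroʳ)
  open import Data.Integer as ℤ using (+_)
  open import Data.Integer.Properties using (drop‿+≤+; pos-*)
  open import Data.Rational.Unnormalised as ℚᵘ using (ℚᵘ; mkℚᵘ; *≤*)
  open import Data.Rational.Unnormalised.Properties using (≤-totalOrder)
  open import Data.List using ([]; _∷_; _++_; map; filter; [_])
  open import Data.List.Relation.Unary.All as All using ()
  open import Data.List.Relation.Unary.Any using (here)
  open import Data.List.Membership.Propositional.Properties
    using (∈-++⁺ˡ; ∈-++⁺ʳ; ∈-++⁻; ∈-map⁺; ∈-map⁻; ∈-filter⁺; ∈-filter⁻)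
  open import Data.List.Relation.Binary.Sublist.Propositional using ([]; _∷_; _∷ʳ_)
    renaming (_⊆_ to _⊑_; ⊆-refl to ⊑-refl)
  open import Data.List.Extrema ≤-totalOrder using (argmin; argmin-all; f[argmin]≤f[xs])
  open import Data.Product using (∃; proj₁; proj₂)
  open import Data.Sum using (inj₁; inj₂)
  open import Relation.Binary.PropositionalEquality as ≡ using (_≡_)

  sublists : List A → List (List A)
  sublists [] = [ [] ]
  sublists (x ∷ xs) = map (x ∷_) (sublists xs) ++ sublists xs

  ∈-sublists⁺ : ∀ {ys xs} → ys ⊑ xs → ys ∈ sublists xs
  ∈-sublists⁺ [] = here ≡.refl
  ∈-sublists⁺ {xs = x ∷ xs} (.x ∷ʳ ys⊑xs) = ∈-++⁺ʳ (map (x ∷_) (sublists xs)) (∈-sublists⁺ ys⊑xs)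
  ∈-sublists⁺ (≡.refl ∷ ys⊑xs) = ∈-++⁺ˡ (∈-map⁺ _ (∈-sublists⁺ ys⊑xs))

  ∈-sublists⁻ : ∀ {ys} xs → ys ∈ sublists xs → ys ⊑ xs
  ∈-sublists⁻ [] (here ≡.refl) = []
  ∈-sublists⁻ (x ∷ xs) ys∈ with ∈-++⁻ (map (x ∷_) (sublists xs)) ys∈
  ... | inj₂ ys∈′ = x ∷ʳ ∈-sublists⁻ xs ys∈′
  ... | inj₁ ys∈x∷ with ∈-map⁻ (x ∷_) ys∈x∷
  ... | zs , zs∈ , ≡.refl = ≡.refl ∷ ∈-sublists⁻ xs zs∈

  private
    -- f Y / length Y (ℚᵘ stores the denominator minus one); a junk value for Y = []
    ratio : (List A → ℕ) → List A → ℚᵘ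
    ratio f Y = mkℚᵘ (+ f Y) (pred (length Y))

    ratio-≤ : ∀ f {W Y} → 0 < length W → 0 < length Y → ratio f W ℚᵘ.≤ ratio f Y →
      f W * length Y ≤ f Y * length W
    ratio-≤ f {W@(_ ∷ _)} {Y@(_ ∷ _)} _ _ (*≤* le) =
      drop‿+≤+ (≡.subst₂ ℤ._≤_ (≡.sym (pos-* (f W) (length Y))) (≡.sym (pos-* (f Y) (length W))) le)

  minimal-ratio-sublist : (f : List A → ℕ) (xs : List A) → 0 < length xs →
    ∃ λ W → W ⊑ xs × 0 < length W × (∀ {Y} → Y ⊑ xs → f W * length Y ≤ f Y * length W)
  minimal-ratio-sublist f xs xs≠[] = W , proj₁ W-candidate , proj₂ W-candidate , minimal
    where
    candidates : List (List A)
    candidates = filter (λ Y → 0 <? length Y) (sublists xs)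

    W : List A
    W = argmin (ratio f) xs candidates

    candidate : ∀ {Y} → Y ∈ candidates → Y ⊑ xs × 0 < length Y
    candidate {Y} Y∈ = let Y∈sublists , Y≠[] = ∈-filter⁻ (λ Y → 0 <? length Y) {xs = sublists xs} Y∈
                       in ∈-sublists⁻ xs Y∈sublists , Y≠[]

    W-candidate : W ⊑ xs × 0 < length W
    W-candidate = argmin-all (ratio f) (⊑-refl , xs≠[]) (All.tabulate candidate)

    minimal : ∀ {Y} → Y ⊑ xs → f W * length Y ≤ f Y * length W
    minimal {[]} _ = ≡.subst (_≤ f [] * length W) (≡.sym (*-zeroʳ (f W))) z≤n
    minimal {Y@(_ ∷ _)} Y⊑xs = ratio-≤ f (proj₂ W-candidate) (s≤s z≤n)
      (All.lookup (f[argmin]≤f[xs] {f = ratio f} xs candidates)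
        (∈-filter⁺ (λ Y → 0 <? length Y) (∈-sublists⁺ Y⊑xs) (s≤s z≤n)))

module NatArithmetic where
  open import Data.Nat using (_+_; _*_; _≤_; _<_; _≮_; NonZero; >-nonZero)
  open import Data.Nat.Properties
  open import Data.Nat.Tactic.RingSolver using (solve)
  open import Data.List using (_∷_; [])
  open import Relation.Binary.PropositionalEquality as ≡ using (_≡_)

  -- The arithmetic of one step of Petridis' argument: N = |X ± A ± C|, q = |X ± A| = i₃ + u₃ splits
  -- X ± A ± c into old and new elements, M = |X ± C|, x = |X| = z + u₂ splits X ± c likewise, y = |Y|.
  petridis-step : ∀ {N N′ u₃ i₃ qY q M M′ u₂ z y x : ℕ} → N′ ≡ N + u₃ → q ≡ i₃ + u₃ → qY ≤ i₃ →
    M′ ≡ M + u₂ → x ≡ z + u₂ → z ≤ y → q * y ≤ qY * x → N * x ≤ q * M → N′ * x ≤ q * M′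
  petridis-step {N} {_} {u₃} {i₃} {qY} {_} {M} {_} {u₂} {z} {y} {_}
                ≡.refl ≡.refl qY≤i₃ ≡.refl ≡.refl z≤y qy≤qYx Nx≤qM =
    +-cancelʳ-≤ (qY * (z + u₂)) _ _ (begin
      (N + u₃) * (z + u₂) + qY * (z + u₂)           ≤⟨ +-monoʳ-≤ ((N + u₃) * (z + u₂)) (*-monoˡ-≤ (z + u₂) qY≤i₃) ⟩
      (N + u₃) * (z + u₂) + i₃ * (z + u₂)           ≡⟨ solve (N ∷ u₃ ∷ i₃ ∷ z ∷ u₂ ∷ []) ⟩
      N * (z + u₂) + (i₃ + u₃) * (z + u₂)           ≤⟨ +-monoˡ-≤ ((i₃ + u₃) * (z + u₂)) Nx≤qM ⟩
      (i₃ + u₃) * M + (i₃ + u₃) * (z + u₂)          ≡⟨ solve (i₃ ∷ u₃ ∷ M ∷ z ∷ u₂ ∷ []) ⟩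
      (i₃ + u₃) * (M + u₂) + (i₃ + u₃) * z          ≤⟨ +-monoʳ-≤ ((i₃ + u₃) * (M + u₂)) (*-monoʳ-≤ (i₃ + u₃) z≤y) ⟩
      (i₃ + u₃) * (M + u₂) + (i₃ + u₃) * y          ≤⟨ +-monoʳ-≤ ((i₃ + u₃) * (M + u₂)) qy≤qYx ⟩
      (i₃ + u₃) * (M + u₂) + qY * (z + u₂)          ∎)
    where open ≤-Reasoning

  greedy-step : ∀ {w g u t N N′ : ℕ} → w ≡ g + u → w ≮ 2 * g → suc t * w ≤ 2 * N → N′ ≡ N + u →
    suc (suc t) * w ≤ 2 * N′
  greedy-step {_} {g} {u} {t} {N} ≡.refl w≮2g inv ≡.refl = begin
    (g + u) + suc t * (g + u)   ≤⟨ +-mono-≤ w≤2u inv ⟩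
    2 * u + 2 * N               ≡⟨ solve (u ∷ N ∷ []) ⟩
    2 * (N + u)                 ∎
    where
    open ≤-Reasoning
    w≤2u : g + u ≤ 2 * u
    w≤2u = +-cancelˡ-≤ (2 * g) _ _ (begin
      2 * g + (g + u)           ≤⟨ +-monoˡ-≤ (g + u) (≮⇒≥ w≮2g) ⟩
      (g + u) + (g + u)         ≡⟨ solve (g ∷ u ∷ []) ⟩
      2 * g + 2 * u             ∎)

  <-half+half : ∀ {w g g′ : ℕ} → w < 2 * g → w < 2 * g′ → w < g + g′
  <-half+half {w} {g} {g′} w<2g w<2g′ = *-cancelˡ-≤ 2 (begin
    2 * suc w               ≡⟨ solve (w ∷ []) ⟩
    suc w + suc w           ≤⟨ +-mono-≤ w<2g w<2g′ ⟩
    2 * g + 2 * g′          ≡⟨ solve (g ∷ g′ ∷ []) ⟩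
    2 * (g + g′)            ∎)
    where open ≤-Reasoning

  covering-bound : ∀ {t w N q n k : ℕ} → 0 < w → suc t * w ≤ 2 * N → N * w ≤ q * q → q * n ≤ k * w →
    suc t * (n * n) ≤ 2 * (k * k)
  covering-bound {t} {w} {N} {q} {n} {k} 0<w inv petridis minimal =
    *-cancelʳ-≤ (suc t * (n * n)) (2 * (k * k)) (w * w) (begin
      suc t * (n * n) * (w * w)      ≡⟨ solve (t ∷ n ∷ w ∷ []) ⟩
      suc t * w * (w * n * n)        ≤⟨ *-monoˡ-≤ (w * n * n) inv ⟩
      2 * N * (w * n * n)            ≡⟨ solve (N ∷ n ∷ w ∷ []) ⟩
      2 * (N * w) * (n * n)          ≤⟨ *-monoˡ-≤ (n * n) (*-monoʳ-≤ 2 petridis) ⟩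
      2 * (q * q) * (n * n)          ≡⟨ solve (q ∷ n ∷ []) ⟩
      2 * ((q * n) * (q * n))        ≤⟨ *-monoʳ-≤ 2 (*-mono-≤ minimal minimal) ⟩
      2 * ((k * w) * (k * w))        ≡⟨ solve (k ∷ w ∷ []) ⟩
      2 * (k * k) * (w * w)          ∎)
    where
    open ≤-Reasoning
    instance
      w≢0 : NonZero w
      w≢0 = >-nonZero 0<w
      w*w≢0 : NonZero (w * w)
      w*w≢0 = m*n≢0 w w

module RationalBound where
  open import Data.Nat as ℕ using ()
  open import Data.Integer as ℤ using (+_)
  import Data.Integer.Properties as ℤₚ
  open import Data.Rational using (ℚ; mkℚ; _/_; _≤_; _*_; _+_; _-_; -_; 1ℚ; NonNegative; Positive; nonNegative; *≤*)
  open import Data.Rational.Properties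
    using (≤-trans; *-monoˡ-≤-nonNeg; *-monoʳ-≤-nonNeg; *-cancelʳ-≤-pos; +-monoˡ-≤; normalize-coprime; nonNegative⁻¹)
    using (module ≤-Reasoning)
  open import Data.Rational.Solver using (module +-*-Solver)
  open import Data.Nat.Coprimality using (1-coprimeTo; sym)
  open import Relation.Binary.PropositionalEquality as ≡ using (_≡_)

  ℕ→ℚ≡mkℚ : ∀ n → ℕ→ℚ n ≡ mkℚ (+ n) 0 (sym (1-coprimeTo n))
  ℕ→ℚ≡mkℚ n = normalize-coprime (sym (1-coprimeTo n))

  ℕ→ℚ-* : ∀ m n → ℕ→ℚ (m ℕ.* n) ≡ ℕ→ℚ m * ℕ→ℚ n
  ℕ→ℚ-* m n rewrite ℕ→ℚ≡mkℚ m | ℕ→ℚ≡mkℚ n = ≡.cong (_/ 1) (ℤₚ.pos-* m n)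

  ℕ→ℚ-+ : ∀ m n → ℕ→ℚ (m ℕ.+ n) ≡ ℕ→ℚ m + ℕ→ℚ n
  ℕ→ℚ-+ m n rewrite ℕ→ℚ≡mkℚ m | ℕ→ℚ≡mkℚ n =
    ≡.cong (_/ 1) (≡.trans (ℤₚ.pos-+ m n) (≡.sym (≡.cong₂ ℤ._+_ (ℤₚ.*-identityʳ (+ m)) (ℤₚ.*-identityʳ (+ n)))))

  ℕ→ℚ-mono-≤ : ∀ {m n} → m ℕ.≤ n → ℕ→ℚ m ≤ ℕ→ℚ n
  ℕ→ℚ-mono-≤ {m} {n} m≤n rewrite ℕ→ℚ≡mkℚ m | ℕ→ℚ≡mkℚ n =
    *≤* (≡.subst₂ ℤ._≤_ (≡.sym (ℤₚ.*-identityʳ (+ m))) (≡.sym (ℤₚ.*-identityʳ (+ n))) (ℤ.+≤+ m≤n))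

  ℕ→ℚ-nonNegative : ∀ n → NonNegative (ℕ→ℚ n)
  ℕ→ℚ-nonNegative n rewrite ℕ→ℚ≡mkℚ n = _

  ℕ→ℚ-positive : ∀ n → Positive (ℕ→ℚ (suc n))
  ℕ→ℚ-positive n rewrite ℕ→ℚ≡mkℚ (suc n) = _

  size-bound-ℚ : ∀ {t n k} (K : ℚ) → 1 ℕ.≤ n → suc t ℕ.* (n ℕ.* n) ℕ.≤ 2 ℕ.* (k ℕ.* k) →
    ℕ→ℚ k ≤ K * ℕ→ℚ n → ℕ→ℚ t ≤ ℕ→ℚ 2 * K * K - 1ℚ
  size-bound-ℚ {t} {n@(suc n-1)} {k} K _ bound k≤Kn = begin
    ℕ→ℚ t                         ≡⟨ solve 1 (λ x → x := (con 1ℚ :+ x) :- con 1ℚ) ≡.refl (ℕ→ℚ t) ⟩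
    (1ℚ + ℕ→ℚ t) - 1ℚ             ≤⟨ +-monoˡ-≤ (- 1ℚ) (≡.subst (_≤ ℕ→ℚ 2 * K * K) (ℕ→ℚ-+ 1 t) t+1≤2K²) ⟩
    ℕ→ℚ 2 * K * K - 1ℚ            ∎
    where
    open ≤-Reasoning
    open +-*-Solver using (solve; _:=_; _:+_; _:*_; _:-_; con)
    N = ℕ→ℚ n
    instance
      k≥0 : NonNegative (ℕ→ℚ k)
      k≥0 = ℕ→ℚ-nonNegative k
      Kn≥0 : NonNegative (K * N)
      Kn≥0 = nonNegative (≤-trans (nonNegative⁻¹ (ℕ→ℚ k)) k≤Kn)
      2≥0 : NonNegative (ℕ→ℚ 2)
      2≥0 = ℕ→ℚ-nonNegative 2
      N²>0 : Positive (N * N)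
      N²>0 = ≡.subst Positive (ℕ→ℚ-* n n) (ℕ→ℚ-positive (n-1 ℕ.+ n-1 ℕ.* n))
    k²≤[KN]² : ℕ→ℚ k * ℕ→ℚ k ≤ (K * N) * (K * N)
    k²≤[KN]² = ≤-trans (*-monoˡ-≤-nonNeg (ℕ→ℚ k) k≤Kn) (*-monoʳ-≤-nonNeg (K * N) k≤Kn)
    t+1≤2K² : ℕ→ℚ (suc t) ≤ ℕ→ℚ 2 * K * K
    t+1≤2K² = *-cancelʳ-≤-pos (N * N) (begin
      ℕ→ℚ (suc t) * (N * N)       ≡⟨ ≡.trans (ℕ→ℚ-* (suc t) (n ℕ.* n)) (≡.cong (ℕ→ℚ (suc t) *_) (ℕ→ℚ-* n n)) ⟨
      ℕ→ℚ (suc t ℕ.* (n ℕ.* n))   ≤⟨ ℕ→ℚ-mono-≤ bound ⟩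
      ℕ→ℚ (2 ℕ.* (k ℕ.* k))       ≡⟨ ≡.trans (ℕ→ℚ-* 2 (k ℕ.* k)) (≡.cong (ℕ→ℚ 2 *_) (ℕ→ℚ-* k k)) ⟩
      ℕ→ℚ 2 * (ℕ→ℚ k * ℕ→ℚ k)     ≤⟨ *-monoˡ-≤-nonNeg (ℕ→ℚ 2) k²≤[KN]² ⟩
      ℕ→ℚ 2 * ((K * N) * (K * N)) ≡⟨ solve 3 (λ a K N → a :* ((K :* N) :* (K :* N)) := (a :* K :* K) :* (N :* N))
                                             ≡.refl (ℕ→ℚ 2) K N ⟩
      ℕ→ℚ 2 * K * K * (N * N)     ∎)

module SignedSums {c ℓ : Level} (G : AbelianGroup c ℓ) where
  open import Data.Bool using (Bool; true; false)
  open import Data.Sum using (inj₁; inj₂)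
  open AbelianGroup G
  open import Algebra.Properties.AbelianGroup G using (⁻¹-∙-comm; ⁻¹-anti-homo‿-)
  open import Algebra.Properties.Group group using (⁻¹-involutive)
  open import Algebra.Properties.CommutativeSemigroup commutativeSemigroup using (interchange)
  open import Relation.Binary.Reasoning.Setoid setoid

  -‿interchange : ∀ a b c d → (a ∙ b) - (c ∙ d) ≈ (a - c) ∙ (b - d)
  -‿interchange a b c d = begin
    (a ∙ b) ∙ (c ∙ d) ⁻¹     ≈⟨ ∙-congˡ (sym (⁻¹-∙-comm c d)) ⟩
    (a ∙ b) ∙ (c ⁻¹ ∙ d ⁻¹)  ≈⟨ interchange a b (c ⁻¹) (d ⁻¹) ⟩
    (a - c) ∙ (b - d)        ∎

  x∙y-z∙y≈x-z : ∀ x y z → (x ∙ y) - (z ∙ y) ≈ x - z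
  x∙y-z∙y≈x-z x y z = begin
    (x ∙ y) - (z ∙ y)    ≈⟨ -‿interchange x y z y ⟩
    (x - z) ∙ (y - y)    ≈⟨ ∙-congˡ (inverseʳ y) ⟩
    (x - z) ∙ ε          ≈⟨ identityʳ (x - z) ⟩
    x - z                ∎

  ∙≈∙⇒-≈- : ∀ {a b a′ b′} → a ∙ b ≈ a′ ∙ b′ → a - b′ ≈ a′ - b
  ∙≈∙⇒-≈- {a} {b} {a′} {b′} eq = begin
    a - b′               ≈⟨ x∙y-z∙y≈x-z a b b′ ⟨
    (a ∙ b) - (b′ ∙ b)   ≈⟨ -‿cong eq (comm b′ b) ⟩
    (a′ ∙ b′) - (b ∙ b′) ≈⟨ x∙y-z∙y≈x-z a′ b′ b ⟩
    a′ - b               ∎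
    where
    -‿cong : ∀ {x x′ y y′} → x ≈ x′ → y ≈ y′ → x - y ≈ x′ - y′
    -‿cong x≈x′ y≈y′ = ∙-cong x≈x′ (⁻¹-cong y≈y′)

  -≈-⇒∙≈∙ : ∀ {a b a′ b′} → a - b′ ≈ a′ - b → a ∙ b ≈ a′ ∙ b′
  -≈-⇒∙≈∙ {a} {b} {a′} {b′} eq = begin
    a ∙ b             ≈⟨ ∙-congˡ (⁻¹-involutive b) ⟨
    a - b ⁻¹          ≈⟨ ∙≈∙⇒-≈- eq ⟩
    a′ - b′ ⁻¹        ≈⟨ ∙-congˡ (⁻¹-involutive b′) ⟩
    a′ ∙ b′           ∎

  -- x ∙ σ b y is x + y for b = true and x - y for b = false; this is how A + A and A - A are treated at once.
  σ : Bool → Carrier → Carrier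
  σ true g = g
  σ false g = g ⁻¹

  σ-cong : ∀ b {g h} → g ≈ h → σ b g ≈ σ b h
  σ-cong true g≈h = g≈h
  σ-cong false g≈h = ⁻¹-cong g≈h

  σ-∙ : ∀ b g h → σ b (g ∙ h) ≈ σ b g ∙ σ b h
  σ-∙ true g h = refl
  σ-∙ false g h = sym (⁻¹-∙-comm g h)

  σ-- : ∀ b g h → σ b (g - h) ≈ σ b g - σ b h
  σ-- true g h = refl
  σ-- false g h = sym (⁻¹-∙-comm g (h ⁻¹))

  σ-involutive : ∀ b g → σ b (σ b g) ≈ g
  σ-involutive true g = refl
  σ-involutive false g = ⁻¹-involutive g

  σ-difference : ∀ b g h → σ b (g - h) ≈ g - h ⊎ σ b (g - h) ≈ h - g
  σ-difference true g h = inj₁ refl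
  σ-difference false g h = inj₂ (⁻¹-anti-homo‿- g h)

  difference-of-translates : ∀ {g x x′ a y a′ y′} → g ∙ x ≈ a ∙ y → g ∙ x′ ≈ a′ ∙ y′ →
    x - x′ ≈ (a - a′) ∙ (y - y′)
  difference-of-translates {g} {x} {x′} {a} {y} {a′} {y′} eq eq′ = begin
    x - x′                  ≈⟨ x∙y-z∙y≈x-z x g x′ ⟨
    (x ∙ g) - (x′ ∙ g)      ≈⟨ ∙-cong (comm x g) (⁻¹-cong (comm x′ g)) ⟩
    (g ∙ x) - (g ∙ x′)      ≈⟨ ∙-cong eq (⁻¹-cong eq′) ⟩
    (a ∙ y) - (a′ ∙ y′)     ≈⟨ -‿interchange a y a′ y′ ⟩
    (a - a′) ∙ (y - y′)     ∎

  σ-transport : ∀ b {u u′ w t t′} → σ b u - σ b u′ ≈ w ∙ (σ b t - σ b t′) → u - u′ ≈ σ b w ∙ (t - t′)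
  σ-transport b {u} {u′} {w} {t} {t′} eq = begin
    u - u′                         ≈⟨ σ-involutive b (u - u′) ⟨
    σ b (σ b (u - u′))             ≈⟨ σ-cong b (σ-- b u u′) ⟩
    σ b (σ b u - σ b u′)           ≈⟨ σ-cong b eq ⟩
    σ b (w ∙ (σ b t - σ b t′))     ≈⟨ σ-∙ b w _ ⟩
    σ b w ∙ σ b (σ b t - σ b t′)   ≈⟨ ∙-congˡ (σ-cong b (σ-- b t t′)) ⟨
    σ b w ∙ σ b (σ b (t - t′))     ≈⟨ ∙-congˡ (σ-involutive b (t - t′)) ⟩
    σ b w ∙ (t - t′)               ∎

module Covering {c ℓ : Level} (G : AbelianGroup c ℓ) where
  open import Data.Bool using (Bool; true; false)
  open import Data.Nat using (_+_; _*_; _≤_; _<_; z≤n; _<?_)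
  open import Data.Nat.Properties
    using (<-≤-trans; *-monoʳ-≤; *-monoˡ-≤; +-identityʳ; m<m+n; ≤-reflexive; ≤-trans; module ≤-Reasoning)
  open import Data.Fin using (Fin; fromℕ<) renaming (_≟_ to _≟ᶠ_)
  open import Data.List using ([]; _∷_; _++_; map; filter; lookup; allFin; cartesianProduct)
  open import Data.List.Properties using (length-map; filter-all; length-tabulate)
  open import Data.List.Relation.Unary.Any using (here; there; index)
  open import Data.List.Relation.Unary.Any.Properties using (lookup-index)
  open import Data.List.Relation.Unary.All as All using (All; all?)
  open import Data.List.Relation.Unary.AllPairs using (AllPairs; []; _∷_)
  open import Data.List.Relation.Unary.AllPairs.Properties as AllPairsₚ using ()
  open import Data.List.Relation.Unary.Unique.Setoid as UniqueS using ()
  open import Data.List.Relation.Unary.Unique.Setoid.Properties as Uniqueₚ using ()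
  open import Data.List.Relation.Unary.Unique.Propositional as UniqueP using ()
  open import Data.List.Relation.Unary.Unique.Propositional.Properties using (allFin⁺)
  open import Data.List.Membership.Setoid as MembershipS using ()
  open import Data.List.Membership.Setoid.Properties as MembershipSₚ using ()
  open import Data.List.Membership.Propositional using (find; lose)
  open import Data.List.Membership.Propositional.Properties
    using (∈-allFin; ∈-++⁺ˡ; ∈-++⁺ʳ; ∈-++⁻; ∈-map⁺; ∈-map⁻; ∈-filter⁺; ∈-filter⁻; ∈-cartesianProduct⁺)
  open import Data.List.Relation.Binary.Sublist.Propositional using () renaming (_⊆_ to _⊑_; ⊆-refl to ⊑-refl; ⊆-trans to ⊑-trans)
  open import Data.List.Relation.Binary.Sublist.Propositional.Properties using (filter-⊆)
  open import Data.List.Relation.Binary.Subset.Propositional using (_⊆_)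
  open import Data.List.Relation.Binary.Subset.Propositional.Properties using (Any-resp-⊆; map⁺) renaming (filter-⊆ to filter-⊆ₛ)
  open import Data.Product using (∃; proj₁; proj₂; map₂)
  open import Data.Product.Properties using (≡-dec)
  open import Data.Sum using (inj₁; inj₂)
  open import Function using (_∘_; flip; id)
  open import Relation.Nullary using (¬_)
  open import Relation.Nullary.Decidable using (_×-dec_; _⊎-dec_; map′)
  open import Relation.Unary using () renaming (Decidable to Decidable₁)
  open import Relation.Unary.Properties using (∁?)
  open import Relation.Binary using (Rel; Decidable)
  open import Relation.Binary.PropositionalEquality as ≡ using (_≡_)
  open import Relation.Binary.Construct.On as On using ()
  open import Relation.Binary.Construct.Closure.Equivalence as EqClosure using (EqClosure)
  open import Relation.Binary.Construct.Closure.ReflexiveTransitive as Star using ()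
  open ListProperties using (length-filter-mono; length-filter-map; filter-map-⊆; filter-pigeonhole; lookup-injective; AllPairs-resp-⊑)
  open CountingMaps using (count-map; count≤)
  open MinimalRatio using (minimal-ratio-sublist)
  open NatArithmetic using (petridis-step; greedy-step; <-half+half; covering-bound)
  open AbelianGroup G
  open SignedSums G
  open import Algebra.Properties.Group group using (∙-cancelʳ)
  open import Algebra.Properties.CommutativeSemigroup commutativeSemigroup using (x∙yz≈y∙xz)
  open MembershipS setoid using () renaming (_∈_ to _∈ᴳ_)
  open UniqueS setoid using () renaming (Unique to Uniqueᴳ)

  module _ (A : List Carrier) (A! : Uniqueᴳ A) (b : Bool)
           (L : List Carrier) (L! : Uniqueᴳ L)
           (L-complete : ∀ i j → (lookup A i ∙ σ b (lookup A j)) ∈ᴳ L) where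

    n : ℕ
    n = length A

    el : Fin n → Carrier
    el = lookup A

    elements : List (Fin n)
    elements = allFin n

    Pair : Set
    Pair = Fin n × Fin n

    sum₂ : Pair → Carrier
    sum₂ (x , a) = el x ∙ σ b (el a)

    _≈₂_ : Rel Pair ℓ
    p ≈₂ q = sum₂ p ≈ sum₂ q

    sum₂∈L : ∀ p → sum₂ p ∈ᴳ L
    sum₂∈L (x , a) = L-complete x a

    _≟₂_ : Decidable _≈₂_
    p ≟₂ q = map′ (MembershipSₚ.index-injective setoid (sum₂∈L p) (sum₂∈L q))
      (λ p≈q → lookup-injective setoid L! _ _
        (trans (sym (lookup-index (sum₂∈L p))) (trans p≈q (lookup-index (sum₂∈L q)))))
      (index (sum₂∈L p) ≟ᶠ index (sum₂∈L q))

    Pairs : DecSetoid _ _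
    Pairs = record
      { Carrier = Pair
      ; _≈_ = _≈₂_
      ; isDecEquivalence = record { isEquivalence = On.isEquivalence sum₂ isEquivalence ; _≟_ = _≟₂_ }
      }

    sum₊ : Pair → Carrier
    sum₊ (a , c) = el a ∙ el c

    _≈₊_ : Rel Pair ℓ
    p ≈₊ q = sum₊ p ≈ sum₊ q

    _≟₊_ : Decidable _≈₊_
    _≟₊_ = via b (λ p q → p ≟₂ q)
      where
      via : ∀ b′ → (∀ (p q : Pair) → Dec (el (proj₁ p) ∙ σ b′ (el (proj₂ p)) ≈ el (proj₁ q) ∙ σ b′ (el (proj₂ q)))) →
        Decidable _≈₊_
      via true dec p q = dec p q
      via false dec (a , c) (a′ , c′) = map′ -≈-⇒∙≈∙ ∙≈∙⇒-≈- (dec (a , c′) (a′ , c))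

    Triple : Set
    Triple = Fin n × Fin n × Fin n

    sum₃ : Triple → Carrier
    sum₃ (x , a , c) = el x ∙ σ b (el a ∙ el c)

    -- Equality of sums of three elements is not decidable in general, so triples are compared by
    -- the equivalence generated by equal partial sums of two of their entries, which is decidable.
    Adjacent : Rel Triple ℓ
    Adjacent (x , a , c) (x′ , a′ , c′) =
      (x ≡ x′ × (a , c) ≈₊ (a′ , c′))
        ⊎ (a ≡ a′ × (x , c) ≈₂ (x′ , c′))
        ⊎ (c ≡ c′ × (x , a) ≈₂ (x′ , a′))

    adjacent? : Decidable Adjacent
    adjacent? (x , a , c) (x′ , a′ , c′) =
      ((x ≟ᶠ x′) ×-dec ((a , c) ≟₊ (a′ , c′))) ⊎-dec ((a ≟ᶠ a′) ×-dec ((x , c) ≟₂ (x′ , c′)))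
        ⊎-dec ((c ≟ᶠ c′) ×-dec ((x , a) ≟₂ (x′ , a′)))

    adjacent-sound : ∀ {t u} → Adjacent t u → sum₃ t ≈ sum₃ u
    adjacent-sound (inj₁ (≡.refl , a+c≈a′+c′)) = ∙-congˡ (σ-cong b a+c≈a′+c′)
    adjacent-sound {x , a , c} {x′ , _ , c′} (inj₂ (inj₁ (≡.refl , x±c≈x′±c′))) = begin
      el x ∙ σ b (el a ∙ el c)        ≈⟨ ∙-congˡ (σ-∙ b (el a) (el c)) ⟩
      el x ∙ (σ b (el a) ∙ σ b (el c)) ≈⟨ x∙yz≈y∙xz (el x) _ _ ⟩
      σ b (el a) ∙ (el x ∙ σ b (el c)) ≈⟨ ∙-congˡ x±c≈x′±c′ ⟩
      σ b (el a) ∙ (el x′ ∙ σ b (el c′)) ≈⟨ x∙yz≈y∙xz _ (el x′) _ ⟩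
      el x′ ∙ (σ b (el a) ∙ σ b (el c′)) ≈⟨ ∙-congˡ (σ-∙ b (el a) (el c′)) ⟨
      el x′ ∙ σ b (el a ∙ el c′)       ∎
      where open import Relation.Binary.Reasoning.Setoid setoid
    adjacent-sound {x , a , c} {x′ , a′ , _} (inj₂ (inj₂ (≡.refl , x±a≈x′±a′))) = begin
      el x ∙ σ b (el a ∙ el c)          ≈⟨ ∙-congˡ (σ-∙ b (el a) (el c)) ⟩
      el x ∙ (σ b (el a) ∙ σ b (el c))  ≈⟨ assoc _ _ _ ⟨
      (el x ∙ σ b (el a)) ∙ σ b (el c)  ≈⟨ ∙-congʳ x±a≈x′±a′ ⟩
      (el x′ ∙ σ b (el a′)) ∙ σ b (el c) ≈⟨ assoc _ _ _ ⟩
      el x′ ∙ (σ b (el a′) ∙ σ b (el c)) ≈⟨ ∙-congˡ (σ-∙ b (el a′) (el c)) ⟨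
      el x′ ∙ σ b (el a′ ∙ el c)        ∎
      where open import Relation.Binary.Reasoning.Setoid setoid

    _≈₃_ : Rel Triple _
    _≈₃_ = EqClosure Adjacent

    ≈₃⇒≈ : ∀ {t u} → t ≈₃ u → sum₃ t ≈ sum₃ u
    ≈₃⇒≈ = EqClosure.gfold isEquivalence sum₃ adjacent-sound

    Triples : DecSetoid _ _
    Triples = record
      { Carrier = Triple
      ; _≈_ = _≈₃_
      ; isDecEquivalence = record
        { isEquivalence = EqClosure.isEquivalence Adjacent
        ; _≟_ = Reachability.eqClosure? (≡-dec _≟ᶠ_ (≡-dec _≟ᶠ_ _≟ᶠ_)) triples-all triples-all-complete adjacent?
        }
      }
      where
      triples-all : List Triple
      triples-all = cartesianProduct elements (cartesianProduct elements elements)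
      triples-all-complete : ∀ t → t ∈ triples-all
      triples-all-complete (x , a , c) = ∈-cartesianProduct⁺ (∈-allFin x)
        (∈-cartesianProduct⁺ (∈-allFin a) (∈-allFin c))

    module C₂ = Counting Pairs
    module C₃ = Counting Triples
    open MembershipS (DecSetoid.setoid Pairs) using () renaming (_∈_ to _∈₂_)
    open MembershipS (DecSetoid.setoid Triples) using () renaming (_∈_ to _∈₃_)
    open import Data.List.Membership.DecSetoid Pairs using () renaming (_∈?_ to _∈₂?_)
    open import Data.List.Membership.DecSetoid Triples using () renaming (_∈?_ to _∈₃?_)

    el-injective : ∀ {i j} → el i ≈ el j → i ≡ j
    el-injective = lookup-injective setoid A! _ _

    pairs : List (Fin n) → List (Fin n) → List Pair
    pairs X [] = []
    pairs X (c ∷ C) = pairs X C ++ map (_, c) X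

    ∣_±A∣ : List (Fin n) → ℕ
    ∣ X ±A∣ = C₂.count (pairs X elements)

    extend : Fin n → Pair → Triple
    extend c (x , a) = x , a , c

    triples : List (Fin n) → List (Fin n) → List Triple
    triples X [] = []
    triples X (c ∷ C) = triples X C ++ map (extend c) (pairs X elements)

    ∈-pairs⁺ : ∀ {x c X C} → x ∈ X → c ∈ C → (x , c) ∈ pairs X C
    ∈-pairs⁺ {C = _ ∷ C} x∈X (here ≡.refl) = ∈-++⁺ʳ (pairs _ C) (∈-map⁺ _ x∈X)
    ∈-pairs⁺ x∈X (there c∈C) = ∈-++⁺ˡ (∈-pairs⁺ x∈X c∈C)

    ∈-pairs⁻ : ∀ {p} X C → p ∈ pairs X C → proj₁ p ∈ X × proj₂ p ∈ C
    ∈-pairs⁻ X (c ∷ C) p∈ with ∈-++⁻ (pairs X C) p∈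
    ... | inj₁ p∈′ = map₂ there (∈-pairs⁻ X C p∈′)
    ... | inj₂ p∈′ with ∈-map⁻ _ p∈′
    ... | x , x∈X , ≡.refl = x∈X , here ≡.refl

    ∈-triples⁺ : ∀ {x c X C} a → x ∈ X → c ∈ C → (x , a , c) ∈ triples X C
    ∈-triples⁺ {C = _ ∷ C} a x∈X (here ≡.refl) = ∈-++⁺ʳ (triples _ C) (∈-map⁺ _ (∈-pairs⁺ x∈X (∈-allFin a)))
    ∈-triples⁺ a x∈X (there c∈C) = ∈-++⁺ˡ (∈-triples⁺ a x∈X c∈C)

    pairs-mono : ∀ {X X′ C} → X ⊆ X′ → pairs X C ⊆ pairs X′ C
    pairs-mono {X} {C = C} X⊆X′ p∈ = let x∈X , c∈C = ∈-pairs⁻ X C p∈ in ∈-pairs⁺ (X⊆X′ x∈X) c∈C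

    extend-covered : ∀ {Y c ts} → (∀ {y} → y ∈ Y → All (λ a → (y , a , c) ∈₃ ts) elements) →
      ∀ {t} → t ∈ map (extend c) (pairs Y elements) → t ∈₃ ts
    extend-covered {Y} {c} covered t∈ with ∈-map⁻ (extend c) t∈
    ... | (y , a) , ya∈ , ≡.refl = All.lookup (covered (proj₁ (∈-pairs⁻ Y elements ya∈))) (∈-allFin a)

    sum₃-extend : ∀ c p → sum₃ (extend c p) ≈ sum₂ p ∙ σ b (el c)
    sum₃-extend c (x , a) = trans (∙-congˡ (σ-∙ b (el a) (el c))) (sym (assoc _ _ _))

    count-extend : ∀ c ps → C₃.count (map (extend c) ps) ≡ C₂.count ps
    count-extend c = count-map Pairs Triples (λ p≈q → EqClosure.return (inj₂ (inj₂ (≡.refl , p≈q))))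
      (λ {p} {q} t≈u → ∙-cancelʳ (σ b (el c)) _ _
        (trans (sym (sum₃-extend c p)) (trans (≈₃⇒≈ t≈u) (sum₃-extend c q))))

    X±c-unique : ∀ {X} c → UniqueP.Unique X → UniqueS.Unique (DecSetoid.setoid Pairs) (map (_, c) X)
    X±c-unique c X! = Uniqueₚ.map⁺ (≡.setoid (Fin n)) (DecSetoid.setoid Pairs) (λ eq → el-injective (∙-cancelʳ _ _ _ eq)) X!

    Minimal : List (Fin n) → Set
    Minimal X = ∀ {Y} → Y ⊑ X → ∣ X ±A∣ * length Y ≤ ∣ Y ±A∣ * length X

    petridis : ∀ {X} → UniqueP.Unique X → Minimal X → ∀ C →
      C₃.count (triples X C) * length X ≤ ∣ X ±A∣ * C₂.count (pairs X C)
    petridis X! minimal [] = z≤n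
    petridis {X} X! minimal (c ∷ C) = petridis-step
      (C₃.count-++ old new) X±A-split Y±A-bound (C₂.count-++ old₂ new₂) X-split Y-bound
      (minimal (filter-⊆ covered? X)) (petridis X! minimal C)
      where
      old = triples X C
      new = map (extend c) (pairs X elements)
      old₂ = pairs X C
      new₂ = map (_, c) X

      Covered : Fin n → Set _
      Covered x = All (λ a → (x , a , c) ∈₃ old) elements

      covered? : Decidable₁ Covered
      covered? x = all? (λ a → (x , a , c) ∈₃? old) elements

      Y = filter covered? X

      X±A-split : ∣ X ±A∣ ≡ C₃.count (filter (_∈₃? old) new) + C₃.count (filter (∁? (_∈₃? old)) new)
      X±A-split = ≡.trans (≡.sym (count-extend c (pairs X elements)))
        (C₃.count-partition (_∈₃? old) (MembershipSₚ.∈-resp-≈ (DecSetoid.setoid Triples)) new)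

      Y±A-bound : ∣ Y ±A∣ ≤ C₃.count (filter (_∈₃? old) new)
      Y±A-bound = ≡.subst (_≤ C₃.count (filter (_∈₃? old) new)) (count-extend c (pairs Y elements))
        (C₃.count-mono (Any-resp-⊆ sub))
        where
        sub : map (extend c) (pairs Y elements) ⊆ filter (_∈₃? old) new
        sub t∈ = ∈-filter⁺ (_∈₃? old) {xs = new} (map⁺ (extend c) (pairs-mono {C = elements} (filter-⊆ₛ covered? X)) t∈)
          (extend-covered (proj₂ ∘ ∈-filter⁻ covered? {xs = X}) t∈)

      X-split : length X ≡ C₂.count (filter (_∈₂? old₂) new₂) + C₂.count (filter (∁? (_∈₂? old₂)) new₂)
      X-split = ≡.trans (≡.sym (length-map _ X)) (≡.trans (≡.sym (C₂.count-of-unique (X±c-unique c X!)))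
        (C₂.count-partition (_∈₂? old₂) (MembershipSₚ.∈-resp-≈ (DecSetoid.setoid Pairs)) new₂))

      covered-by : ∀ {x} → (x , c) ∈₂ old₂ → Covered x
      covered-by {x} xc∈ = All.tabulate λ {a} _ → let (x′ , c′) , x′c′∈ , xc≈x′c′ = find xc∈
                                                      x′∈X , c′∈C = ∈-pairs⁻ X C x′c′∈
        in lose (∈-triples⁺ a x′∈X c′∈C) (EqClosure.return (inj₂ (inj₁ (≡.refl , xc≈x′c′))))

      Y-bound : C₂.count (filter (_∈₂? old₂) new₂) ≤ length Y
      Y-bound = begin
        C₂.count (filter (_∈₂? old₂) new₂)   ≤⟨ C₂.count-mono (Any-resp-⊆ sub) ⟩
        C₂.count (map (_, c) Y)              ≤⟨ C₂.count≤length (map (_, c) Y) ⟩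
        length (map (_, c) Y)                ≡⟨ length-map _ Y ⟩
        length Y                             ∎
        where
        open ≤-Reasoning
        sub : filter (_∈₂? old₂) new₂ ⊆ map (_, c) Y
        sub = filter-map-⊆ (_∈₂? old₂) (_, c) covered? covered-by X

    ∣A±A∣≤∣L∣ : ∣ elements ±A∣ ≤ length L
    ∣A±A∣≤∣L∣ = count≤ Pairs (index ∘ sum₂∈L) (MembershipSₚ.index-injective setoid (sum₂∈L _) (sum₂∈L _))
      (pairs elements elements)

    open Sumsets G using (SubsetG; ⟦_⟧; _⊕_; _⊖_) renaming (_⊆_ to _⊆ᴳ_)

    ∈A : ∀ i → ⟦ A ⟧ (el i)
    ∈A = MembershipSₚ.∈-lookup setoid A

    index-of : ∀ {x} → ⟦ A ⟧ x → ∃ λ i → x ≈ el i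
    index-of x∈A = index x∈A , lookup-index x∈A

    D : SubsetG
    D = ⟦ A ⟧ ⊖ ⟦ A ⟧

    σ-difference∈D : ∀ u v → D (σ b (el u - el v))
    σ-difference∈D u v with σ-difference b (el u) (el v)
    ... | inj₁ eq = el u , el v , ∈A u , ∈A v , eq
    ... | inj₂ eq = el v , el u , ∈A v , ∈A u , eq

    module Translates (W : List (Fin n)) (W⊑elements : W ⊑ elements) (W≠[] : 0 < length W)
                      (W-minimal : ∀ {Y} → Y ⊑ elements → ∣ W ±A∣ * length Y ≤ ∣ Y ±A∣ * length W) where

      W! : UniqueP.Unique W
      W! = AllPairs-resp-⊑ W⊑elements (allFin⁺ n)

      translate : Pair → List Triple
      translate (a , c) = map (λ w → w , a , c) W

      covered : List Pair → List Triple
      covered [] = []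
      covered (p ∷ T) = covered T ++ translate p

      ∈-covered⁺ : ∀ {w q T} → w ∈ W → q ∈ T → (w , q) ∈ covered T
      ∈-covered⁺ {T = _ ∷ T} w∈W (here ≡.refl) = ∈-++⁺ʳ (covered T) (∈-map⁺ _ w∈W)
      ∈-covered⁺ w∈W (there q∈T) = ∈-++⁺ˡ (∈-covered⁺ w∈W q∈T)

      ∈-covered⁻ : ∀ {t} T → t ∈ covered T → proj₁ t ∈ W × proj₂ t ∈ T
      ∈-covered⁻ (q ∷ T) t∈ with ∈-++⁻ (covered T) t∈
      ... | inj₁ t∈′ = map₂ there (∈-covered⁻ T t∈′)
      ... | inj₂ t∈′ with ∈-map⁻ _ t∈′
      ... | w , w∈W , ≡.refl = w∈W , here ≡.refl

      translate-unique : ∀ p → UniqueS.Unique (DecSetoid.setoid Triples) (translate p)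
      translate-unique p = Uniqueₚ.map⁺ (≡.setoid (Fin n)) (DecSetoid.setoid Triples)
        (λ t≈u → el-injective (∙-cancelʳ _ _ _ (≈₃⇒≈ t≈u))) W!

      is-covered? : (T : List Pair) (p : Pair) → Decidable₁ (λ w → (w , p) ∈₃ covered T)
      is-covered? T p w = (w , p) ∈₃? covered T

      coverage : List Pair → Pair → ℕ
      coverage T p = length (filter (is-covered? T p) W)

      Good : List Pair → Pair → Set
      Good T p = length W < 2 * coverage T p

      good? : ∀ T p → Dec (Good T p)
      good? T p = length W <? 2 * coverage T p

      W-split : ∀ T p → length W ≡ coverage T p + C₃.count (filter (∁? (_∈₃? covered T)) (translate p))
      W-split T p = begin-equality
        length W                         ≡⟨ length-map _ W ⟨
        length (translate p)             ≡⟨ C₃.count-of-unique (translate-unique p) ⟨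
        C₃.count (translate p)           ≡⟨ C₃.count-partition (_∈₃? covered T) (MembershipSₚ.∈-resp-≈ (DecSetoid.setoid Triples)) (translate p) ⟩
        C₃.count (filter (_∈₃? covered T) (translate p)) + C₃.count (filter (∁? (_∈₃? covered T)) (translate p))
          ≡⟨ ≡.cong (_+ C₃.count (filter (∁? (_∈₃? covered T)) (translate p)))
               (≡.trans (C₃.count-of-unique (Uniqueₚ.filter⁺ (DecSetoid.setoid Triples) (_∈₃? covered T) (translate-unique p)))
                        (length-filter-map (_∈₃? covered T) (λ w → w , p) W)) ⟩
        coverage T p + C₃.count (filter (∁? (_∈₃? covered T)) (translate p)) ∎
        where open ≤-Reasoning

      Invariant : List Pair → Set
      Invariant T = suc (length T) * length W ≤ 2 * C₃.count (covered T)

      DistinctSums : List Pair → Set ℓ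
      DistinctSums = AllPairs (λ p q → ¬ p ≈₊ q)

      good-mono : ∀ {T T′ p} → T ⊆ T′ → Good T p → Good T′ p
      good-mono {T} {T′} {p} T⊆T′ = flip <-≤-trans (*-monoʳ-≤ 2
        (length-filter-mono (is-covered? T p) (is-covered? T′ p) (Any-resp-⊆ covered-mono) W))
        where
        covered-mono : covered T ⊆ covered T′
        covered-mono t∈ with ∈-covered⁻ T t∈
        ... | w∈W , q∈T = ∈-covered⁺ w∈W (T⊆T′ q∈T)

      all-covered⇒good : ∀ {T p} → (∀ {w} → w ∈ W → (w , p) ∈₃ covered T) → Good T p
      all-covered⇒good {T} {p} all = ≡.subst (λ m → length W < 2 * m)
        (≡.sym (≡.cong length (filter-all (is-covered? T p) (All.tabulate all))))
        (≡.subst (length W <_) (≡.cong (length W +_) (≡.sym (+-identityʳ (length W)))) (m<m+n (length W) W≠[]))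

      good-after-adding : ∀ T p → Good (p ∷ T) p
      good-after-adding T p =
        all-covered⇒good {p ∷ T} {p} (λ w∈W → lose (∈-covered⁺ {T = p ∷ T} w∈W (here ≡.refl)) Star.ε)

      add-invariant : ∀ T p → ¬ Good T p → Invariant T → Invariant (p ∷ T)
      add-invariant T p bad inv =
        greedy-step {g = coverage T p} {t = length T} (W-split T p) bad inv (C₃.count-++ (covered T) (translate p))

      add-distinct : ∀ T p → ¬ Good T p → DistinctSums T → DistinctSums (p ∷ T)
      add-distinct T p bad distinct = All.tabulate (λ q∈T p≈q → bad (all-covered⇒good {T} {p} (λ w∈W →
        lose (∈-covered⁺ w∈W q∈T) (EqClosure.return (inj₁ (≡.refl , p≈q)))))) ∷ distinct

      open Greedy Good good? using (greedy; greedy-invariant; greedy-good)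

      -- any pair will do: it only makes the invariant hold from the start
      start : Pair
      start = w₀ , w₀
        where w₀ = lookup W (fromℕ< W≠[])

      all-pairs : List Pair
      all-pairs = cartesianProduct elements elements

      T : List Pair
      T = greedy (start ∷ []) all-pairs

      T-invariant : Invariant T × DistinctSums T
      T-invariant = greedy-invariant (λ T → Invariant T × DistinctSums T)
        (λ T p bad (inv , distinct) → add-invariant T p bad inv , add-distinct T p bad distinct)
        (start ∷ []) all-pairs (start-invariant , All.[] ∷ [])
        where
        start-invariant : Invariant (start ∷ [])
        start-invariant = ≤-reflexive (≡.cong (2 *_)
          (≡.sym (≡.trans (C₃.count-of-unique (translate-unique start)) (length-map _ W))))

      T-good : ∀ p → Good T p
      T-good (a , c) = greedy-good good-mono good-after-adding (start ∷ []) all-pairs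
        (∈-cartesianProduct⁺ (∈-allFin a) (∈-allFin c))

      covered-T⊆triples : covered T ⊆ triples W elements
      covered-T⊆triples t∈ = let w∈W , _ = ∈-covered⁻ T t∈ in ∈-triples⁺ _ w∈W (∈-allFin _)

      sum-difference-decomposition : ∀ p p′ → ∃ λ w₁ → ∃ λ w₂ → ∃ λ q → ∃ λ q′ → q ∈ T × q′ ∈ T ×
        sum₊ p - sum₊ p′ ≈ σ b (el w₁ - el w₂) ∙ (sum₊ q - sum₊ q′)
      sum-difference-decomposition p p′ =
        let w , _ , wp∈ , wp′∈ = filter-pigeonhole (is-covered? T p) (is-covered? T p′) W
              (<-half+half {g = coverage T p} {g′ = coverage T p′} (T-good p) (T-good p′))
            (w₁ , q) , t∈ , wp≈w₁q = find wp∈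
            (w₂ , q′) , t′∈ , wp′≈w₂q′ = find wp′∈
        in w₁ , w₂ , q , q′ , proj₂ (∈-covered⁻ T t∈) , proj₂ (∈-covered⁻ T t′∈) ,
           σ-transport b (difference-of-translates (≈₃⇒≈ wp≈w₁q) (≈₃⇒≈ wp′≈w₂q′))

      size-bound : suc (length T) * (n * n) ≤ 2 * (length L * length L)
      size-bound = covering-bound {t = length T} {N = C₃.count (triples W elements)} {q = ∣ W ±A∣} {n = n} {k = length L}
        W≠[]
        (≤-trans (proj₁ T-invariant) (*-monoʳ-≤ 2 (C₃.count-mono (Any-resp-⊆ covered-T⊆triples))))
        (petridis W! (λ Y⊑W → W-minimal (⊑-trans Y⊑W W⊑elements)) elements)
        (≤-trans (≡.subst (λ m → ∣ W ±A∣ * m ≤ ∣ elements ±A∣ * length W) (length-tabulate id) (W-minimal ⊑-refl))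
                 (*-monoˡ-≤ (length W) ∣A±A∣≤∣L∣))

      T-sums : List Carrier
      T-sums = map sum₊ T

      sum₊∈T-sums : ∀ {q} → q ∈ T → ⟦ T-sums ⟧ (sum₊ q)
      sum₊∈T-sums = MembershipSₚ.∈-map⁺ (≡.setoid Pair) setoid (λ { ≡.refl → refl })

      T-sums-unique : Uniqueᴳ T-sums
      T-sums-unique = AllPairsₚ.map⁺ (proj₂ T-invariant)

      T-sums⊆A+A : ⟦ T-sums ⟧ ⊆ᴳ (⟦ A ⟧ ⊕ ⟦ A ⟧)
      T-sums⊆A+A x x∈ = let (a , c) , _ , x≈a+c = MembershipSₚ.∈-map⁻ (≡.setoid Pair) setoid x∈
                        in el a , el c , ∈A a , ∈A c , x≈a+c

      T-sums-size : suc (length T-sums) * (n * n) ≤ 2 * (length L * length L)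
      T-sums-size = ≡.subst (λ t → suc t * (n * n) ≤ 2 * (length L * length L)) (≡.sym (length-map sum₊ T)) size-bound

      D+D⊆D+T-T : (D ⊕ D) ⊆ᴳ (D ⊕ (⟦ T-sums ⟧ ⊖ ⟦ T-sums ⟧))
      D+D⊆D+T-T z (u , v , (x₁ , y₁ , x₁∈ , y₁∈ , u≈) , (x₂ , y₂ , x₂∈ , y₂∈ , v≈) , z≈u+v) =
        let i₁ , x₁≈ = index-of x₁∈
            j₁ , y₁≈ = index-of y₁∈
            i₂ , x₂≈ = index-of x₂∈
            j₂ , y₂≈ = index-of y₂∈
            w₁ , w₂ , q , q′ , q∈T , q′∈T , decomposition = sum-difference-decomposition (i₁ , i₂) (j₁ , j₂)
        in σ b (el w₁ - el w₂) , sum₊ q - sum₊ q′ , σ-difference∈D w₁ w₂ ,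
           (sum₊ q , sum₊ q′ , sum₊∈T-sums q∈T , sum₊∈T-sums q′∈T , refl) ,
           (begin
             z                                        ≈⟨ z≈u+v ⟩
             u ∙ v                                    ≈⟨ ∙-cong u≈ v≈ ⟩
             (x₁ - y₁) ∙ (x₂ - y₂)                    ≈⟨ ∙-cong (∙-cong x₁≈ (⁻¹-cong y₁≈)) (∙-cong x₂≈ (⁻¹-cong y₂≈)) ⟩
             (el i₁ - el j₁) ∙ (el i₂ - el j₂)        ≈⟨ -‿interchange (el i₁) (el i₂) (el j₁) (el j₂) ⟨
             sum₊ (i₁ , i₂) - sum₊ (j₁ , j₂)          ≈⟨ decomposition ⟩
             σ b (el w₁ - el w₂) ∙ (sum₊ q - sum₊ q′) ∎)
        where open import Relation.Binary.Reasoning.Setoid setoid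

    difference-cover : 0 < n → Σ (List Carrier) λ T → Uniqueᴳ T × ⟦ T ⟧ ⊆ᴳ (⟦ A ⟧ ⊕ ⟦ A ⟧)
      × suc (length T) * (n * n) ≤ 2 * (length L * length L) × (D ⊕ D) ⊆ᴳ (D ⊕ (⟦ T ⟧ ⊖ ⟦ T ⟧))
    difference-cover n>0 =
      let W , W⊑elements , W≠[] , W-minimal =
            minimal-ratio-sublist ∣_±A∣ elements (≡.subst (0 <_) (≡.sym (length-tabulate id)) n>0)
          open Translates W W⊑elements W≠[] W-minimal
      in T-sums , T-sums-unique , T-sums⊆A+A , T-sums-size , D+D⊆D+T-T

module SumsetIteration {c ℓ : Level} (G : AbelianGroup c ℓ) where
  open import Data.Nat using (zero)
  open AbelianGroup G
  open Sumsets G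

  iterate-cover : ∀ {D E : SubsetG} → (D ⊕ D) ⊆ (D ⊕ E) → ∀ m → (suc (suc m) · D) ⊆ (D ⊕ (suc m · E))
  iterate-cover {D} {E} D+D⊆D+E zero z (u , w , u∈D , (v , e , v∈D , Level.lift e≈ε , w≈v+e) , z≈u+w) =
    let d , τ , d∈D , τ∈E , u+v≈d+τ = D+D⊆D+E (u ∙ v) (u , v , u∈D , v∈D , refl)
    in d , τ ∙ ε , d∈D , (τ , ε , τ∈E , Level.lift refl , refl) , (begin
      z           ≈⟨ z≈u+w ⟩
      u ∙ w       ≈⟨ ∙-congˡ (trans w≈v+e (trans (∙-congˡ e≈ε) (identityʳ v))) ⟩
      u ∙ v       ≈⟨ u+v≈d+τ ⟩
      d ∙ τ       ≈⟨ ∙-congˡ (identityʳ τ) ⟨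
      d ∙ (τ ∙ ε) ∎)
    where open import Relation.Binary.Reasoning.Setoid setoid
  iterate-cover {D} {E} D+D⊆D+E (suc m) z (u , w , u∈D , w∈ , z≈u+w) =
    let d , r , d∈D , r∈ , w≈d+r = iterate-cover D+D⊆D+E m w w∈
        d′ , τ , d′∈D , τ∈E , u+d≈d′+τ = D+D⊆D+E (u ∙ d) (u , d , u∈D , d∈D , refl)
    in d′ , τ ∙ r , d′∈D , (τ , r , τ∈E , r∈ , refl) , (begin
      z             ≈⟨ z≈u+w ⟩
      u ∙ w         ≈⟨ ∙-congˡ w≈d+r ⟩
      u ∙ (d ∙ r)   ≈⟨ assoc u d r ⟨
      (u ∙ d) ∙ r   ≈⟨ ∙-congʳ u+d≈d′+τ ⟩
      (d′ ∙ τ) ∙ r  ≈⟨ assoc d′ τ r ⟩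
      d′ ∙ (τ ∙ r)  ∎)
    where open import Relation.Binary.Reasoning.Setoid setoid

open import Data.Rational using (ℚ; _≤_; _*_; _-_; 1ℚ)
open import Data.Bool using (Bool; true; false)

module _ {c ℓ : Level} (G : AbelianGroup c ℓ) where
  open import Data.List using (lookup)
  open import Data.List.Membership.Setoid.Properties as MembershipSₚ using ()
  open import Relation.Binary.PropositionalEquality as ≡ using ()
  open AbelianGroup G using (Carrier; setoid; _≈_; _∙_; refl)
  open Sumsets G
  open SignedSums G using (σ)
  open Covering G using (difference-cover)
  open SumsetIteration G using (iterate-cover)
  open RationalBound using (size-bound-ℚ)

  -- definitionally, X ⊕⟨ true ⟩ Y is X ⊕ Y and X ⊕⟨ false ⟩ Y is X ⊖ Y
  _⊕⟨_⟩_ : SubsetG → Bool → SubsetG → SubsetG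
  (X ⊕⟨ b ⟩ Y) z = Σ Carrier λ x → Σ Carrier λ y → X x × Y y × (z ≈ x ∙ σ b y)

  theorem-for-sign : ∀ b (A : List Carrier) → UniqS.Unique setoid A → length A ≥ 1 → (K : ℚ) →
    (Σ ℕ λ k → HasCard (⟦ A ⟧ ⊕⟨ b ⟩ ⟦ A ⟧) k × (ℕ→ℚ k ≤ K * ℕ→ℚ (length A))) →
    Σ (List Carrier) λ T →
      UniqS.Unique setoid T
      × (⟦ T ⟧ ⊆ (⟦ A ⟧ ⊕ ⟦ A ⟧))
      × (ℕ→ℚ (length T) ≤ ℕ→ℚ 2 * K * K - 1ℚ)
      × ((m : ℕ) → m ≥ 1 → (suc m · (⟦ A ⟧ ⊖ ⟦ A ⟧)) ⊆ ((⟦ A ⟧ ⊖ ⟦ A ⟧) ⊕ (m · (⟦ T ⟧ ⊖ ⟦ T ⟧))))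
  theorem-for-sign b A A! n≥1 K (_ , (L , L! , ≡.refl , A±A⊆L , _) , ∣L∣≤Kn) =
    let T , T! , T⊆A+A , size , D+D⊆D+T-T =
          difference-cover A A! b L L! (λ i j → A±A⊆L _ (el i , el j , ∈A i , ∈A j , refl)) n≥1
    in T , T! , T⊆A+A , size-bound-ℚ {length T} {length A} {length L} K n≥1 size ∣L∣≤Kn , λ { (suc m) _ → iterate-cover D+D⊆D+T-T m }
    where
    el = lookup A
    ∈A = MembershipSₚ.∈-lookup setoid A

mainTheorem6 : {c ℓ : Level} (G : AbelianGroup c ℓ) →
    let open Sumsets G in
    (A : List (AbelianGroup.Carrier G)) → UniqS.Unique (AbelianGroup.setoid G) A → length A ≥ 1 →
    (K : ℚ) →
    ((Σ ℕ λ k → HasCard (⟦ A ⟧ ⊕ ⟦ A ⟧) k × (ℕ→ℚ k ≤ K * ℕ→ℚ (length A)))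
      ⊎ (Σ ℕ λ k → HasCard (⟦ A ⟧ ⊖ ⟦ A ⟧) k × (ℕ→ℚ k ≤ K * ℕ→ℚ (length A)))) →
    Σ (List (AbelianGroup.Carrier G)) λ T →
      UniqS.Unique (AbelianGroup.setoid G) T
      × (⟦ T ⟧ ⊆ (⟦ A ⟧ ⊕ ⟦ A ⟧))
      × (ℕ→ℚ (length T) ≤ ℕ→ℚ 2 * K * K - 1ℚ)
      × ((m : ℕ) → m ≥ 1 →
          (suc m · (⟦ A ⟧ ⊖ ⟦ A ⟧)) ⊆ ((⟦ A ⟧ ⊖ ⟦ A ⟧) ⊕ (m · (⟦ T ⟧ ⊖ ⟦ T ⟧))))
mainTheorem6 G A A! n≥1 K = [ theorem-for-sign G true A A! n≥1 K , theorem-for-sign G false A A! n≥1 K ]′
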